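{- Let $G=(V,E)$ satisfy the standing assumptions and have highway dimension at most $h$. Let $k\ge 0$ and $\lambda>0$. There is a constant $c$ depending only on $h,k,\lambda$ such that: for every $r>0$, every $(r,k)$ vertex cover $C$ of $G$, and every $r'>0$ with $r'/r\le\lambda$, the shortcut graph $G(C,r')$ has maximum degree at most $c$.
   Context: Standing assumptions: $G$ is a finite connected undirected graph, edge weights at least $1$, shortest paths unique ($p(u,w)$, length $d(u,w)$), every edge is the shortest path between its endpoints. $B(v,r)=\{v': d(v,v')\le r\}$; $\mathrm{maxedge}(p)$ is the maximum edge weight on path $p$. Highway dimension: an $r$-witness of a shortest path $p$ from $u$ to $w$ is a shortest path $p'$ of length at least $r$ containing $p$, with endpoints $u$ or a neighbor of $u$, and $w$ or a neighbor of $w$; $p$ is $r$-significant if it has one; $d(v,q)$ is the distance from $v$ to the nearest vertex of $q$; $S(v,r)$ is the set of $r$-significant paths with an $r$-witness $p'$ satisfying $d(v,p')\le 2r$; the highway dimension is the least $h$ such that for all $r>0,v\in V$ some $C\subseteq V$, $|C|\le h$, meets every path of $S(v,r)$. An $(r,k)$ vertex cover is a set $C\subseteq V$ such that (1) every shortest path $p(v_1,v_2)$ with $d(v_1,v_2)>r$ and $\mathrm{maxedge}(p(v_1,v_2))\le r$ contains a vertex of $C$, and (2) $|B(v,2r)\cap C|\le k$ for all $v\in V$. For $C\subseteq V$ and $r>0$, the shortcut graph $G(C,r)$ has vertex set $C$ and an edge $\{v_1,v_2\}$ of weight $d(v_1,v_2)$ iff $d(v_1,v_2)\le r$ and $p(v_1,v_2)$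 contains no element of $C$ other than $v_1,v_2$.
   Formalization: The edge weights, the parameters r, r′ and λ, and the radii r in the definition of highway dimension are all rational. -}

module Defs where

open import Data.Nat using (ℕ)
open import Data.Bool using (Bool; true; false; T)
open import Data.Fin using (Fin)
open import Data.Fin.Subset using (Subset; _∈_; ∣_∣)
open import Data.List using (List; []; _∷_)
open import Data.List.Membership.Propositional as L using ()
open import Data.List.Relation.Binary.Infix.Heterogeneous using (Infix)
open import Data.Rational using (ℚ; 0ℚ; 1ℚ; _+_; _*_; _⊔_; _≤_; _<_)
open import Data.Product using (Σ; ∃; ∃-syntax; _×_; _,_)
open import Data.Sum using (_⊎_)
open import Relation.Binary.PropositionalEquality using (_≡_; _≢_)
open import Relation.Nullary using (¬_)

-- Finite weighted undirected (simple) graphs on vertex set Fin n.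
-- adj u v = true iff {u,v} is an edge; wt u v is its weight
-- (the value of wt on non-edges is irrelevant).

record WGraph : Set where
  field
    n         : ℕ
    adj       : Fin n → Fin n → Bool
    wt        : Fin n → Fin n → ℚ
    adj-sym   : ∀ u v → adj u v ≡ adj v u
    adj-irrefl : ∀ v → adj v v ≡ false
    wt-sym    : ∀ u v → wt u v ≡ wt v u

module _ (G : WGraph) where
  open WGraph G

  V : Set
  V = Fin n

  Adj : V → V → Set
  Adj u v = T (adj u v)

  data IsWalk : V → V → List V → Set where
    single : ∀ v → IsWalk v v (v ∷ [])
    step   : ∀ {u v w p} → Adj u v → IsWalk v w (v ∷ p) → IsWalk u w (u ∷ v ∷ p)

  len : List V → ℚ
  len (u ∷ v ∷ p) = wt u v + len (v ∷ p)
  len _           = 0ℚ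

  maxedge : List V → ℚ
  maxedge (u ∷ v ∷ p) = wt u v ⊔ maxedge (v ∷ p)
  maxedge _           = 0ℚ

  IsShortest : V → V → List V → Set
  IsShortest u w p = IsWalk u w p × (∀ q → IsWalk u w q → len p ≤ len q)

  record Standing : Set where
    field
      weight-≥1     : ∀ u v → Adj u v → 1ℚ ≤ wt u v
      connected     : ∀ u v → ∃[ p ] IsWalk u v p
      unique-sp     : ∀ u v p q → IsShortest u v p → IsShortest u v q → p ≡ q
      edge-shortest : ∀ u v → Adj u v → IsShortest u v (u ∷ v ∷ [])

  DistLe : V → V → ℚ → Set
  DistLe u w r = ∃[ p ] (IsShortest u w p × len p ≤ r)

  OnPath : V → List V → Set
  OnPath x p = x L.∈ p

  DistPathLe : V → List V → ℚ → Set
  DistPathLe v q r = ∃[ x ] (OnPath x q × DistLe v x r)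

  SelfOrNbr : V → V → Set
  SelfOrNbr u x = x ≡ u ⊎ Adj u x

  IsWitness : ℚ → V → V → List V → List V → Set
  IsWitness r u w p p' =
    ∃[ u' ] ∃[ w' ] (SelfOrNbr u u' × SelfOrNbr w w' × IsShortest u' w' p'
                     × r ≤ len p' × Infix _≡_ p p')

  InS : V → ℚ → List V → Set
  InS v r p = ∃[ u ] ∃[ w ] (IsShortest u w p ×
                ∃[ p' ] (IsWitness r u w p p' × DistPathLe v p' (r + r)))

  Hits : Subset n → List V → Set
  Hits C p = ∃[ x ] (OnPath x p × x ∈ C)

  HighwayDimLe : ℕ → Set
  HighwayDimLe h = ∀ (r : ℚ) → 0ℚ < r → ∀ (v : V) →
    ∃[ C ] (∣ C ∣ Data.Nat.≤ h × (∀ p → InS v r p → Hits C p))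

  BallCapLe : Subset n → V → ℚ → ℕ → Set
  BallCapLe C v r k = ∃[ D ] ((∀ x → (x ∈ D → x ∈ C × DistLe v x (r + r))
                                     × (x ∈ C × DistLe v x (r + r) → x ∈ D))
                             × ∣ D ∣ Data.Nat.≤ k)

  IsVertexCover : ℚ → ℕ → Subset n → Set
  IsVertexCover r k C =
    (∀ v₁ v₂ p → IsShortest v₁ v₂ p → r < len p → maxedge p ≤ r → Hits C p)
    × (∀ v → BallCapLe C v r k)

  ShortcutAdj : Subset n → ℚ → V → V → Set
  ShortcutAdj C r v₁ v₂ =
    v₁ ∈ C × v₂ ∈ C × v₁ ≢ v₂ ×
    ∃[ p ] (IsShortest v₁ v₂ p × len p ≤ r ×
            (∀ x → OnPath x p → x ∈ C → x ≡ v₁ ⊎ x ≡ v₂))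

  ShortcutMaxDegLe : Subset n → ℚ → ℕ → Set
  ShortcutMaxDegLe C r c = ∀ v → v ∈ C →
    ∃[ D ] ((∀ x → (x ∈ D → ShortcutAdj C r v x) × (ShortcutAdj C r v x → x ∈ D))
           × ∣ D ∣ Data.Nat.≤ c)

{-# OPTIONS --safe #-}
module Submission where

open import Defs
open import Data.Bool using (true; false; T)
open import Data.Bool.Properties using (T?)
open import Data.Empty using (⊥-elim)
open import Data.Fin as Fin using (Fin; zero; suc)
open import Data.Fin.Subset as Subset using (Subset; _∪_; ∣_∣; ⊥)
open import Data.Fin.Subset.Properties using (p⊆p∪q; q⊆p∪q; p⊆q⇒∣p∣≤∣q∣; ∣⊥∣≡0; _∈?_)
open import Data.Integer as ℤ using (+_; -[1+_])
import Data.Integer.Properties as ℤ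
open import Data.List using (List; []; _∷_; [_]; length; filter; cartesianProductWith; allFin)
open import Data.List.Membership.Propositional using (_∈_)
open import Data.List.Membership.Propositional.Properties using (∈-cartesianProductWith⁺; ∈-allFin; ∈-filter⁺)
open import Data.List.Relation.Binary.Infix.Heterogeneous using (here; there)
open import Data.List.Relation.Binary.Pointwise using (≡⇒Pointwise-≡)
open import Data.List.Relation.Binary.Prefix.Heterogeneous.Properties using (fromPointwise)
open import Data.List.Relation.Unary.All as All using (All; all?)
open import Data.List.Relation.Unary.All.Properties using (all-filter)
open import Data.List.Relation.Unary.Any using (here; there)
open import Data.Nat as ℕ using (ℕ; zero; suc; _^_)
import Data.Nat.Coprimality as Coprime
import Data.Nat.Properties as ℕ
open import Data.Product using (∃-syntax; _×_; _,_; proj₁; proj₂)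
open import Data.Rational using (ℚ; mkℚ; 0ℚ; 1ℚ; _+_; -_; _*_; _≤_; _<_; _≤?_; *≤*; nonNegative)
open import Data.Rational.Properties
import Data.Rational.Unnormalised as ℚᵘ
import Data.Rational.Unnormalised.Properties as ℚᵘ
open import Data.Sum using (_⊎_; inj₁; inj₂; [_,_]′)
open import Data.Unit using (tt)
open import Data.Vec using ([]; _∷_; lookup; tabulate; here; there)
open import Data.Vec.Properties using (lookup∘tabulate; []=⇒lookup; lookup⇒[]=)
open import Function using (_∘_)
open import Relation.Binary.Bundles using (DecTotalOrder)
open import Relation.Binary.PropositionalEquality using (_≡_; _≢_; refl; sym; trans; cong; subst; subst₂; module ≡-Reasoning)
open import Relation.Nullary using (Dec; yes; no; does; isYes; ¬?)
open import Relation.Nullary.Decidable using (dec-true; toSum; toWitness; isYes≗does; map′; _×-dec_; _⊎-dec_; _→-dec_)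
open import Relation.Unary using (Pred; Decidable)
open import Data.List.Extrema (DecTotalOrder.totalOrder ≤-decTotalOrder) using (argmin; argmin-all; f[argmin]≤f[⊤]; f[argmin]≤f[xs])

-- Every neighbour of v in G(C,r') is a vertex of C in the ball B(v,r'), so it suffices to
-- bound |C ∩ B(y,R)| for R ≥ λr.  Property (2) of the vertex cover bounds it by k for R = 2r.  Enlarging R by r ≤ R costs a factor of at most 1 + h: if
-- z ∈ C has R < d(y,z) ≤ 2R, the last edge of p(y,z) that crosses distance R from z starts an
-- R-witness of the tail after it, and that witness passes through z, within 2R of y.  So the
-- tail is hit by one of the h hubs of S(y,R), and that hub lies within R of z.  Hence
-- C ∩ B(y, R + r) is covered by B(y,R) and the radius-R balls around the hubs, and after
-- N ≥ λ such steps the radius (N + 2)r exceeds λr with the bound (1 + h)^N k.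

fromℕ : ℕ → ℚ
fromℕ m = mkℚ (+ m) 0 (Coprime.sym (Coprime.1-coprimeTo m))

fromℕ-suc : ∀ m → fromℕ (suc m) ≡ 1ℚ + fromℕ m
fromℕ-suc m = toℚᵘ-injective (ℚᵘ.≃-sym (ℚᵘ.≃-trans (toℚᵘ-homo-+ 1ℚ (fromℕ m)) (ℚᵘ.*≡* (begin
  (+ 1 ℤ.+ + m ℤ.* + 1) ℤ.* + 1 ≡⟨ ℤ.*-identityʳ _ ⟩
  + 1 ℤ.+ + m ℤ.* + 1           ≡⟨ cong (ℤ._+_ (+ 1)) (ℤ.*-identityʳ (+ m)) ⟩
  + suc m                       ≡⟨ ℤ.*-identityʳ _ ⟨
  + suc m ℤ.* + 1               ∎))))
  where open ≡-Reasoning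

fromℕ-mono-≤ : ∀ {a b} → a ℕ.≤ b → fromℕ a ≤ fromℕ b
fromℕ-mono-≤ a≤b = *≤* (ℤ.*-monoʳ-≤-nonNeg (+ 1) (ℤ.+≤+ a≤b))

archimedean : ∀ q → ∃[ N ] q ≤ fromℕ N
archimedean (mkℚ (+ a)    d _) = a , *≤* (ℤ.*-monoˡ-≤-nonNeg (+ a) (ℤ.+≤+ (ℕ.s≤s ℕ.z≤n)))
archimedean (mkℚ -[1+ a ] d _) = 0 , *≤* ℤ.-≤+

+-cancelˡ-≤ : ∀ a {x y} → a + x ≤ a + y → x ≤ y
+-cancelˡ-≤ a {x} {y} a+x≤a+y = subst₂ _≤_ (-a+[a+z]≡z x) (-a+[a+z]≡z y) (+-monoʳ-≤ (- a) a+x≤a+y)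
  where
  -a+[a+z]≡z : ∀ z → - a + (a + z) ≡ z
  -a+[a+z]≡z z = begin
    - a + (a + z) ≡⟨ +-assoc (- a) a z ⟨
    - a + a + z   ≡⟨ cong (_+ z) (+-inverseˡ a) ⟩
    0ℚ + z        ≡⟨ +-identityˡ z ⟩
    z             ∎
    where open ≡-Reasoning

p≤q+p : ∀ {p q} → 0ℚ ≤ q → p ≤ q + p
p≤q+p {p} {q} 0≤q = subst (_≤ q + p) (+-identityˡ p) (+-monoˡ-≤ p 0≤q)

radius : ℚ → ℕ → ℚ
radius r zero    = r + r
radius r (suc i) = r + radius r i

r≤radius : ∀ {r} → 0ℚ ≤ r → ∀ i → r ≤ radius r i
r≤radius r≥0 zero    = p≤q+p r≥0
r≤radius r≥0 (suc i) = ≤-trans (r≤radius r≥0 i) (p≤q+p r≥0)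

fromℕ*r≤radius : ∀ {r} → 0ℚ ≤ r → ∀ i → fromℕ i * r ≤ radius r i
fromℕ*r≤radius {r} r≥0 zero    = subst (_≤ r + r) (sym (*-zeroˡ r)) (+-mono-≤ r≥0 r≥0)
fromℕ*r≤radius {r} r≥0 (suc i) = begin
  fromℕ (suc i) * r    ≡⟨ cong (_* r) (fromℕ-suc i) ⟩
  (1ℚ + fromℕ i) * r   ≡⟨ *-distribʳ-+ r 1ℚ (fromℕ i) ⟩
  1ℚ * r + fromℕ i * r ≡⟨ cong (_+ fromℕ i * r) (*-identityˡ r) ⟩
  r + fromℕ i * r      ≤⟨ +-monoʳ-≤ r (fromℕ*r≤radius r≥0 i) ⟩
  r + radius r i       ∎
  where open ≤-Reasoning

∣p∪q∣≤∣p∣+∣q∣ : ∀ {n} (p q : Subset n) → ∣ p ∪ q ∣ ℕ.≤ ∣ p ∣ ℕ.+ ∣ q ∣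
∣p∪q∣≤∣p∣+∣q∣ []          []          = ℕ.z≤n
∣p∪q∣≤∣p∣+∣q∣ (true ∷ p)  (true ∷ q)  = ℕ.s≤s (ℕ.≤-trans (∣p∪q∣≤∣p∣+∣q∣ p q) (ℕ.+-monoʳ-≤ ∣ p ∣ (ℕ.n≤1+n ∣ q ∣)))
∣p∪q∣≤∣p∣+∣q∣ (true ∷ p)  (false ∷ q) = ℕ.s≤s (∣p∪q∣≤∣p∣+∣q∣ p q)
∣p∪q∣≤∣p∣+∣q∣ (false ∷ p) (true ∷ q)  = ℕ.≤-trans (ℕ.s≤s (∣p∪q∣≤∣p∣+∣q∣ p q)) (ℕ.≤-reflexive (sym (ℕ.+-suc ∣ p ∣ ∣ q ∣)))
∣p∪q∣≤∣p∣+∣q∣ (false ∷ p) (false ∷ q) = ∣p∪q∣≤∣p∣+∣q∣ p q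

⋃[_]_ : ∀ {m n} → Subset m → (Fin m → Subset n) → Subset n
⋃[ []        ] T = ⊥
⋃[ true  ∷ H ] T = T zero ∪ ⋃[ H ] (T ∘ suc)
⋃[ false ∷ H ] T = ⋃[ H ] (T ∘ suc)

∣⋃[H]T∣≤∣H∣*c : ∀ {m n c} (H : Subset m) (T : Fin m → Subset n) →
                (∀ x → ∣ T x ∣ ℕ.≤ c) → ∣ ⋃[ H ] T ∣ ℕ.≤ ∣ H ∣ ℕ.* c
∣⋃[H]T∣≤∣H∣*c {n = n} []          T ∣T∣≤c = ℕ.≤-reflexive (∣⊥∣≡0 n)
∣⋃[H]T∣≤∣H∣*c (true  ∷ H) T ∣T∣≤c =
  ℕ.≤-trans (∣p∪q∣≤∣p∣+∣q∣ (T zero) (⋃[ H ] (T ∘ suc)))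
            (ℕ.+-mono-≤ (∣T∣≤c zero) (∣⋃[H]T∣≤∣H∣*c H (T ∘ suc) (∣T∣≤c ∘ suc)))
∣⋃[H]T∣≤∣H∣*c (false ∷ H) T ∣T∣≤c = ∣⋃[H]T∣≤∣H∣*c H (T ∘ suc) (∣T∣≤c ∘ suc)

x∈H∧z∈T[x]⇒z∈⋃[H]T : ∀ {m n} (H : Subset m) (T : Fin m → Subset n) {x z} →
                     x Subset.∈ H → z Subset.∈ T x → z Subset.∈ ⋃[ H ] T
x∈H∧z∈T[x]⇒z∈⋃[H]T (true  ∷ H) T here        z∈T = p⊆p∪q (⋃[ H ] (T ∘ suc)) z∈T
x∈H∧z∈T[x]⇒z∈⋃[H]T (true  ∷ H) T (there x∈H) z∈T =
  q⊆p∪q (T zero) (⋃[ H ] (T ∘ suc)) (x∈H∧z∈T[x]⇒z∈⋃[H]T H (T ∘ suc) x∈H z∈T)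
x∈H∧z∈T[x]⇒z∈⋃[H]T (false ∷ H) T (there x∈H) z∈T = x∈H∧z∈T[x]⇒z∈⋃[H]T H (T ∘ suc) x∈H z∈T

module _ {n p} {P : Pred (Fin n) p} (P? : Decidable P) where

  decSubset : Subset n
  decSubset = tabulate (does ∘ P?)

  ∈-decSubset⁺ : ∀ {x} → P x → x Subset.∈ decSubset
  ∈-decSubset⁺ {x} px = lookup⇒[]= x decSubset (trans (lookup∘tabulate _ x) (dec-true (P? x) px))

  ∈-decSubset⁻ : ∀ {x} → x Subset.∈ decSubset → P x
  ∈-decSubset⁻ {x} x∈ = toWitness (subst T (sym isYes≡true) tt)
    where
    isYes≡true : isYes (P? x) ≡ true
    isYes≡true = begin
      isYes (P? x)       ≡⟨ isYes≗does (P? x) ⟩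
      does (P? x)        ≡⟨ lookup∘tabulate (does ∘ P?) x ⟨
      lookup decSubset x ≡⟨ []=⇒lookup x∈ ⟩
      true               ∎
      where open ≡-Reasoning

lists≤ : ∀ {a} {A : Set a} → List A → ℕ → List (List A)
lists≤ xs zero    = [ [] ]
lists≤ xs (suc L) = [] ∷ cartesianProductWith _∷_ xs (lists≤ xs L)

∈-lists≤ : ∀ {a} {A : Set a} {xs : List A} L {ys} →
           (∀ y → y ∈ xs) → length ys ℕ.≤ L → ys ∈ lists≤ xs L
∈-lists≤ zero    {[]}     _           _            = here refl
∈-lists≤ (suc L) {[]}     _           _            = here refl
∈-lists≤ (suc L) {y ∷ ys} xs-complete (ℕ.s≤s ys≤L) =
  there (∈-cartesianProductWith⁺ _∷_ (xs-complete y) (∈-lists≤ L xs-complete ys≤L))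

module _ (G : WGraph) where
  open WGraph G

  -- |C ∩ B(y,R)| ≤ c for all y, witnessed by a superset so that the ball need not be decided.
  BallCapAtMost : Subset n → ℚ → ℕ → Set
  BallCapAtMost C R c = ∀ y → ∃[ D ] ((∀ z → z Subset.∈ C → DistLe G y z R → z Subset.∈ D) × ∣ D ∣ ℕ.≤ c)

  BallCapLe⇒BallCapAtMost : ∀ {C r k} → (∀ v → BallCapLe G C v r k) → BallCapAtMost C (r + r) k
  BallCapLe⇒BallCapAtMost ballCap y with ballCap y
  ... | D , D≡C∩B , ∣D∣≤k = D , (λ z z∈C y~z → proj₂ (D≡C∩B z) (z∈C , y~z)) , ∣D∣≤k

module _ {G : WGraph} where
  open WGraph G

  walk? : ∀ u w p → Dec (IsWalk G u w p)
  walk? u w []          = no λ ()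
  walk? u w (x ∷ [])    with u Fin.≟ x | w Fin.≟ x
  ... | yes refl | yes refl = yes (single u)
  ... | no  u≢x  | _        = no λ { (single _) → u≢x refl }
  ... | yes _    | no  w≢x  = no λ { (single _) → w≢x refl }
  walk? u w (x ∷ y ∷ p) with u Fin.≟ x | T? (adj x y) | walk? y w (y ∷ p)
  ... | yes refl | yes x~y | yes wk = yes (step x~y wk)
  ... | no  u≢x  | _       | _      = no λ { (step _ _) → u≢x refl }
  ... | yes refl | no  x≁y | _      = no λ { (step x~y _) → x≁y x~y }
  ... | yes refl | yes _   | no  ¬wk = no λ { (step _ wk) → ¬wk wk }

  walk-end∈ : ∀ {u w p} → IsWalk G u w p → w ∈ p
  walk-end∈ (single _) = here refl
  walk-end∈ (step _ w) = there (walk-end∈ w)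

  shortest-tail : ∀ {y z v p} → IsShortest G y z (y ∷ v ∷ p) → IsShortest G v z (v ∷ p)
  shortest-tail {y} {z} {v} {p} (step y~v walk , minimal) = walk , tail-minimal
    where
    -- Matching on the walk exposes q as v ∷ _, so that len G (y ∷ q) unfolds to wt y v + len G q.
    tail-minimal : ∀ q → IsWalk G v z q → len G (v ∷ p) ≤ len G q
    tail-minimal q wq@(single _) = +-cancelˡ-≤ (wt y v) (minimal (y ∷ q) (step y~v wq))
    tail-minimal q wq@(step _ _) = +-cancelˡ-≤ (wt y v) (minimal (y ∷ q) (step y~v wq))

  edge-crossing-radius : ∀ {ρ y z} p → 0ℚ ≤ ρ → IsShortest G y z p → ρ < len G p →
    ∃[ u′ ] ∃[ u ] ∃[ q ] (Adj G u′ u × IsShortest G u′ z (u′ ∷ u ∷ q) ×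
                           len G (u ∷ q) ≤ ρ × ρ < len G (u′ ∷ u ∷ q))
  -- Deciding with a `with` here would hide the descent on p from the termination checker.
  edge-crossing-radius _ ρ≥0 (single _ , _) ρ<0 = ⊥-elim (<-irrefl refl (<-≤-trans ρ<0 ρ≥0))
  edge-crossing-radius (_ ∷ v ∷ p) ρ≥0 sp@(step y~v _ , _) ρ<len =
    [ (λ tail≤ρ → _ , v , p , y~v , sp , tail≤ρ , ρ<len)
    , (λ tail≰ρ → edge-crossing-radius (v ∷ p) ρ≥0 (shortest-tail sp) (≰⇒> tail≰ρ))
    ]′ (toSum (len G (v ∷ p) ≤? _))

  crossing-tail∈S : ∀ {ρ y z u′ u q} → Adj G u′ u → IsShortest G u′ z (u′ ∷ u ∷ q) →
    ρ < len G (u′ ∷ u ∷ q) → DistLe G y z (ρ + ρ) → InS G y ρ (u ∷ q)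
  crossing-tail∈S {ρ} {z = z} {u′} {u} {q} u′~u sp ρ<len y~z =
    u , z , shortest-tail sp , u′ ∷ u ∷ q , witness , (z , walk-end∈ (proj₁ sp) , y~z)
    where
    witness : IsWitness G ρ u z (u ∷ q) (u′ ∷ u ∷ q)
    witness = u′ , _ , inj₂ (subst T (adj-sym u′ u) u′~u) , inj₁ refl , sp , <⇒≤ ρ<len ,
              there (here (fromPointwise (≡⇒Pointwise-≡ refl)))

module _ {G : WGraph} (standing : Standing G) where
  open WGraph G
  open Standing standing

  wt-nonneg : ∀ {u v} → Adj G u v → 0ℚ ≤ wt u v
  wt-nonneg u~v = ≤-trans (nonNegative⁻¹ 1ℚ) (weight-≥1 _ _ u~v)

  fromℕ[#edges]≤len : ∀ {u w p} → IsWalk G u w p → fromℕ (ℕ.pred (length p)) ≤ len G p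
  fromℕ[#edges]≤len (single _)   = ≤-refl
  fromℕ[#edges]≤len (step {u} {v} {p = p} u~v w) = begin
    fromℕ (suc (length p)) ≡⟨ fromℕ-suc (length p) ⟩
    1ℚ + fromℕ (length p)  ≤⟨ +-mono-≤ (weight-≥1 u v u~v) (fromℕ[#edges]≤len w) ⟩
    wt u v + len G (v ∷ p) ∎
    where open ≤-Reasoning

  -- A walk with more than N ≥ len p₀ edges is no shorter than p₀, so the minimum over the
  -- finitely many walks with at most N edges is a minimum over all walks.
  shortest-path : ∀ u w → ∃[ p ] IsShortest G u w p
  shortest-path u w with connected u w
  ... | p₀ , walk₀ with archimedean (len G p₀)
  ...   | N , len₀≤N =
    p , argmin-all (len G) walk₀ (all-filter (walk? u w) (lists≤ (allFin n) N)) , minimal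
    where
    candidates : List (List (Fin n))
    candidates = filter (walk? u w) (lists≤ (allFin n) N)

    p : List (Fin n)
    p = argmin (len G) p₀ candidates

    minimal : ∀ q → IsWalk G u w q → len G p ≤ len G q
    minimal q wq with length q ℕ.≤? N
    ... | yes short = All.lookup (f[argmin]≤f[xs] {f = len G} p₀ candidates)
                        (∈-filter⁺ (walk? u w) (∈-lists≤ N ∈-allFin short) wq)
    ... | no  long  = begin
      len G p                    ≤⟨ f[argmin]≤f[⊤] {f = len G} p₀ candidates ⟩
      len G p₀                   ≤⟨ len₀≤N ⟩
      fromℕ N                    ≤⟨ fromℕ-mono-≤ (ℕ.<⇒≤pred (ℕ.≰⇒> long)) ⟩
      fromℕ (ℕ.pred (length q))  ≤⟨ fromℕ[#edges]≤len wq ⟩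
      len G q                    ∎
      where open ≤-Reasoning

  shortest⇒DistLe : ∀ {x y z p} → IsShortest G y z p → x ∈ p → DistLe G x z (len G p)
  shortest⇒DistLe sp@(single _ , _) (here refl) = _ , sp , ≤-refl
  shortest⇒DistLe sp@(step _ _ , _) (here refl) = _ , sp , ≤-refl
  shortest⇒DistLe sp@(step y~v _ , _) (there x∈p) with shortest⇒DistLe (shortest-tail sp) x∈p
  ... | q , sq , q≤tail = q , sq , ≤-trans q≤tail (p≤q+p (wt-nonneg y~v))

  hub-near-endpoint : ∀ {ρ y H z p} → 0ℚ ≤ ρ → (∀ q → InS G y ρ q → Hits G H q) →
    IsShortest G y z p → ρ < len G p → len G p ≤ ρ + ρ → ∃[ x ] (x Subset.∈ H × DistLe G x z ρ)
  hub-near-endpoint ρ≥0 hits sp ρ<len len≤2ρ with edge-crossing-radius _ ρ≥0 sp ρ<len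
  ... | _ , _ , _ , u′~u , sp′ , tail≤ρ , ρ<len′ with hits _ (crossing-tail∈S u′~u sp′ ρ<len′ (_ , sp , len≤2ρ))
  ...   | x , x∈tail , x∈H with shortest⇒DistLe (shortest-tail sp′) x∈tail
  ...     | q , sq , q≤tail = x , x∈H , q , sq , ≤-trans q≤tail tail≤ρ

  ballCap-grow : ∀ {h C R r c} → HighwayDimLe G h → 0ℚ < R → r ≤ R →
                 BallCapAtMost G C R c → BallCapAtMost G C (r + R) (suc h ℕ.* c)
  ballCap-grow {h} {C} {R} {r} {c} hd R>0 r≤R ballCap y = ball y ∪ ⋃[ H ] ball , covered , size
    where
    ball : Fin n → Subset n
    ball x = proj₁ (ballCap x)

    H : Subset n
    H = proj₁ (hd R R>0 y)

    covered : ∀ z → z Subset.∈ C → DistLe G y z (r + R) → z Subset.∈ ball y ∪ ⋃[ H ] ball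
    covered z z∈C (p , sp , len≤r+R) with len G p ≤? R
    ... | yes near = p⊆p∪q (⋃[ H ] ball) (proj₁ (proj₂ (ballCap y)) z z∈C (p , sp , near))
    ... | no  far  with hub-near-endpoint (<⇒≤ R>0) (proj₂ (proj₂ (hd R R>0 y))) sp (≰⇒> far)
                                          (≤-trans len≤r+R (+-monoˡ-≤ R r≤R))
    ...   | x , x∈H , x~z = q⊆p∪q (ball y) (⋃[ H ] ball)
                              (x∈H∧z∈T[x]⇒z∈⋃[H]T H ball x∈H (proj₁ (proj₂ (ballCap x)) z z∈C x~z))

    size : ∣ ball y ∪ ⋃[ H ] ball ∣ ℕ.≤ c ℕ.+ h ℕ.* c
    size = ℕ.≤-trans (∣p∪q∣≤∣p∣+∣q∣ (ball y) (⋃[ H ] ball))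
             (ℕ.+-mono-≤ (proj₂ (proj₂ (ballCap y)))
               (ℕ.≤-trans (∣⋃[H]T∣≤∣H∣*c H ball (proj₂ ∘ proj₂ ∘ ballCap))
                          (ℕ.*-monoˡ-≤ c (proj₁ (proj₂ (hd R R>0 y))))))

  ballCap-radius : ∀ {h k C r} → HighwayDimLe G h → 0ℚ < r → BallCapAtMost G C (r + r) k →
                   ∀ i → BallCapAtMost G C (radius r i) (suc h ^ i ℕ.* k)
  ballCap-radius {k = k} {C} {r} hd r>0 ballCap zero =
    subst (BallCapAtMost G C (r + r)) (sym (ℕ.*-identityˡ k)) ballCap
  ballCap-radius {h} {k} {C} {r} hd r>0 ballCap (suc i) =
    subst (BallCapAtMost G C (radius r (suc i))) (sym (ℕ.*-assoc (suc h) (suc h ^ i) k))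
      (ballCap-grow hd (<-≤-trans r>0 (r≤radius r≥0 i)) (r≤radius r≥0 i) (ballCap-radius hd r>0 ballCap i))
    where
    r≥0 : 0ℚ ≤ r
    r≥0 = <⇒≤ r>0

  -- By uniqueness of shortest paths, the existential in ShortcutAdj only concerns p(v,x).
  shortcutAdj? : ∀ C r v x → Dec (ShortcutAdj G C r v x)
  shortcutAdj? C r v x with shortest-path v x
  ... | p , sp = map′ fromPath toPath conditions?
    where
    Interior : Fin n → Set
    Interior y = y Subset.∈ C → y ≡ v ⊎ y ≡ x

    Conditions : Set
    Conditions = v Subset.∈ C × x Subset.∈ C × v ≢ x × len G p ≤ r × All Interior p

    conditions? : Dec Conditions
    conditions? = v ∈? C ×-dec x ∈? C ×-dec ¬? (v Fin.≟ x) ×-dec len G p ≤? r ×-dec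
                  all? (λ y → y ∈? C →-dec (y Fin.≟ v ⊎-dec y Fin.≟ x)) p

    fromPath : Conditions → ShortcutAdj G C r v x
    fromPath (v∈C , x∈C , v≢x , len≤r , interior) =
      v∈C , x∈C , v≢x , p , sp , len≤r , λ y y∈p → All.lookup interior y∈p

    toPath : ShortcutAdj G C r v x → Conditions
    toPath (v∈C , x∈C , v≢x , q , sq , len≤r , interior) with unique-sp v x q p sq sp
    ... | refl = v∈C , x∈C , v≢x , len≤r , All.tabulate (λ {y} → interior y)

  shortcut-degree≤ : ∀ {C R r c} → BallCapAtMost G C R c → r ≤ R → ShortcutMaxDegLe G C r c
  shortcut-degree≤ {C} {R} {r} {c} ballCap r≤R v _ =
    neighbours , (λ x → ∈-decSubset⁻ (shortcutAdj? C r v) , ∈-decSubset⁺ (shortcutAdj? C r v)) ,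
    ℕ.≤-trans (p⊆q⇒∣p∣≤∣q∣ neighbours⊆ball) (proj₂ (proj₂ (ballCap v)))
    where
    neighbours : Subset n
    neighbours = decSubset (shortcutAdj? C r v)
    neighbours⊆ball : neighbours Subset.⊆ proj₁ (ballCap v)
    neighbours⊆ball x∈ with ∈-decSubset⁻ (shortcutAdj? C r v) x∈
    ... | _ , x∈C , _ , p , sp , len≤r , _ = proj₁ (proj₂ (ballCap v)) _ x∈C (p , sp , ≤-trans len≤r r≤R)

mainTheorem5 : ∀ (h k : ℕ) (λ' : ℚ) → 0ℚ < λ' →
    ∃[ c ] (∀ (G : WGraph) → Standing G → HighwayDimLe G h →
    ∀ (r : ℚ) → 0ℚ < r → ∀ C → IsVertexCover G r k C →
    ∀ (r' : ℚ) → 0ℚ < r' → r' ≤ λ' * r →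
    ShortcutMaxDegLe G C r' c)
mainTheorem5 h k λ' _ with archimedean λ'
... | N , λ'≤N = suc h ^ N ℕ.* k , λ G standing hd r r>0 C (_ , ballCap) r' _ r'≤λ'r →
  let r'≤radius : r' ≤ radius r N
      r'≤radius = begin
        r'           ≤⟨ r'≤λ'r ⟩
        λ' * r       ≤⟨ *-monoʳ-≤-nonNeg r {{nonNegative (<⇒≤ r>0)}} λ'≤N ⟩
        fromℕ N * r  ≤⟨ fromℕ*r≤radius (<⇒≤ r>0) N ⟩
        radius r N   ∎
  in shortcut-degree≤ standing
       (ballCap-radius standing hd r>0 (BallCapLe⇒BallCapAtMost G {r = r} ballCap) N) r'≤radius
  where open ≤-Reasoning
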